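{- For every proper Christoffel word $\mathtt0u\mathtt1\in\{\mathtt0,\mathtt1\}^*$, the Markoff number $\mu(\mathtt0u\mathtt1)_{12}$ equals the number of perfect matchings of the snake graph $G(\mathtt0\gamma(u)\mathtt0)$: $\mu(\mathtt0u\mathtt1)_{12}=\#M(\mathtt0\gamma(u)\mathtt0)$.
   Context: Christoffel words: $\mathtt0$, $\mathtt1$, $\mathtt0\mathtt1$ are Christoffel words, and if $u,v,uv$ are Christoffel words then so are $uuv$ and $uvv$; proper means neither $\mathtt0$ nor $\mathtt1$. $\mu$ is the monoid homomorphism from $\{\mathtt0,\mathtt1\}^*$ to $\mathrm{GL}_2(\mathbb{Z})$ with $\mu(\mathtt0)=\begin{pmatrix}2&1\\1&1\end{pmatrix}$, $\mu(\mathtt1)=\begin{pmatrix}5&2\\2&1\end{pmatrix}$; $M_{12}$ is the (1,2) entry. $\gamma$ is the monoid morphism with $\gamma(\mathtt0)=\mathtt0\mathtt0$, $\gamma(\mathtt1)=\mathtt0\mathtt1\mathtt1\mathtt0$. For a word $p$, $\vec p=(|p|_\mathtt0,|p|_\mathtt1)$; $S_g$ is the set of four edges of the unit square with lower-left corner $g\in\mathbb{Z}^2$. The snake graph $G(w)$ has vertex set $\{\vec p:p\text{ prefix of }w\}+\{(0,0),(1,0),(0,1),(1,1)\}$ and edge set $\bigcup_{p\text{ prefix of }w}S_{\vec p}$; $M(w)$ is its set of perfect matchings. -}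

module Defs where

open import Data.Nat using (ℕ; zero; suc; _+_; _*_)
open import Data.Nat.Properties using (_≟_)
open import Data.List using (List; []; _∷_; _++_; [_]; map; concatMap; length; filter; inits; deduplicate)
open import Data.List.Relation.Unary.All using (All; all?)
open import Data.Product using (_×_; _,_; proj₁; proj₂)
open import Data.Product.Properties using (≡-dec)
open import Relation.Binary.PropositionalEquality using (_≡_)
open import Relation.Binary.Definitions using (DecidableEquality)
open import Relation.Nullary using (Dec; ¬_)
open import Relation.Nullary.Decidable using (_⊎-dec_)

data Letter : Set where
  𝟎 𝟏 : Letter

Word : Set
Word = List Letter

data Christoffel : Word → Set where
  ch0  : Christoffel [ 𝟎 ]
  ch1  : Christoffel [ 𝟏 ]
  ch01 : Christoffel (𝟎 ∷ 𝟏 ∷ [])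
  chuuv : ∀ {u v} → Christoffel u → Christoffel v → Christoffel (u ++ v) →
          Christoffel (u ++ u ++ v)
  chuvv : ∀ {u v} → Christoffel u → Christoffel v → Christoffel (u ++ v) →
          Christoffel (u ++ v ++ v)

ProperChristoffel : Word → Set
ProperChristoffel w = Christoffel w × ¬ (w ≡ [ 𝟎 ]) × ¬ (w ≡ [ 𝟏 ])

-- 2x2 matrices (a b / c d); all matrices in the image of μ have entries in ℕ
record Mat : Set where
  constructor mat
  field
    a11 a12 a21 a22 : ℕ
open Mat public

_⊗_ : Mat → Mat → Mat
mat a b c d ⊗ mat e f g h = mat (a * e + b * g) (a * f + b * h) (c * e + d * g) (c * f + d * h)

I₂ : Mat
I₂ = mat 1 0 0 1

μL : Letter → Mat
μL 𝟎 = mat 2 1 1 1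
μL 𝟏 = mat 5 2 2 1

μ : Word → Mat
μ []      = I₂
μ (x ∷ w) = μL x ⊗ μ w

M₁₂ : Mat → ℕ
M₁₂ = a12

γL : Letter → Word
γL 𝟎 = 𝟎 ∷ 𝟎 ∷ []
γL 𝟏 = 𝟎 ∷ 𝟏 ∷ 𝟏 ∷ 𝟎 ∷ []

γ : Word → Word
γ = concatMap γL

-- lattice points (all relevant points have nonnegative coordinates)
Point : Set
Point = ℕ × ℕ

_≟P_ : DecidableEquality Point
_≟P_ = ≡-dec _≟_ _≟_

-- an edge is an (unordered) pair of points, stored as an ordered pair
Edge : Set
Edge = Point × Point

_≟E_ : DecidableEquality Edge
_≟E_ = ≡-dec _≟P_ _≟P_

count0 count1 : Word → ℕ
count0 [] = 0
count0 (𝟎 ∷ w) = suc (count0 w)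
count0 (𝟏 ∷ w) = count0 w
count1 [] = 0
count1 (𝟎 ∷ w) = count1 w
count1 (𝟏 ∷ w) = suc (count1 w)

vec : Word → Point
vec p = count0 p , count1 p

corners : Point → List Point
corners (x , y) = (x , y) ∷ (suc x , y) ∷ (x , suc y) ∷ (suc x , suc y) ∷ []

S : Point → List Edge
S (x , y) = ((x , y) , (suc x , y)) ∷ ((x , y) , (x , suc y))
          ∷ ((suc x , y) , (suc x , suc y)) ∷ ((x , suc y) , (suc x , suc y)) ∷ []

prefixes : Word → List Word
prefixes = inits

vertices : Word → List Point
vertices w = deduplicate _≟P_ (concatMap (λ p → corners (vec p)) (prefixes w))

edges : Word → List Edge
edges w = deduplicate _≟E_ (concatMap (λ p → S (vec p)) (prefixes w))

subsets : {A : Set} → List A → List (List A)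
subsets []      = [] ∷ []
subsets (x ∷ xs) = let r = subsets xs in map (x ∷_) r ++ r

_∈ₑ_ : Point → Edge → Set
v ∈ₑ e = (v ≡ proj₁ e) Data.Sum.⊎ (v ≡ proj₂ e)
  where import Data.Sum

_∈ₑ?_ : (v : Point) (e : Edge) → Dec (v ∈ₑ e)
v ∈ₑ? e = (v ≟P proj₁ e) ⊎-dec (v ≟P proj₂ e)

degree : Point → List Edge → ℕ
degree v M = length (filter (v ∈ₑ?_) M)

IsPerfectMatching : List Point → List Edge → Set
IsPerfectMatching V M = All (λ v → degree v M ≡ 1) V

isPerfectMatching? : (V : List Point) (M : List Edge) → Dec (IsPerfectMatching V M)
isPerfectMatching? V M = all? (λ v → degree v M ≟ 1) V

matchings : Word → List (List Edge)
matchings w = filter (isPerfectMatching? (vertices w)) (subsets (edges w))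

#M : Word → ℕ
#M w = length (matchings w)

{-# OPTIONS --safe #-}
module Submission where

-- G(a w) is a translated copy of G(w) plus two new vertices (its left side if
-- a = 0, its bottom side if a = 1) and three new edges.  So a perfect matching
-- of G(a w) is a choice of new edges covering the new vertices once, together
-- with a matching of the copy that leaves the other endpoints of the chosen
-- edges free.  Three counts are closed under this step: perfect matchings of
-- G(w), and those of G(w) with its left, resp. bottom, side deleted; they obey
-- a linear recurrence in the first letter.  Over the blocks γ(0) = 00 and
-- γ(1) = 0110 the pair (full, noLeft) is transformed by μ(0), resp. μ(1),
-- conjugated by (q , s) ↦ (q + s , q).  Hence G(γ(u) 0) has
-- (full, noLeft) = (q + s , q) for the second column (q , s) of μ(u 1), and one
-- more letter 0 gives full = 2q + s = μ(0 u 1)₁₂.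

open import Defs
open import Data.List using (_∷_; _++_; [_])
open import Relation.Binary.PropositionalEquality using (_≡_)

open import Algebra.Bundles using (CommutativeMonoid)
import Algebra.Properties.CommutativeSemigroup as CommutativeSemigroupProperties
open import Data.Bool using (Bool; true; false; _∧_; if_then_else_)
open import Data.Bool.ListAction using (all; and)
open import Data.Bool.Properties using (∧-assoc; ∧-commutativeMonoid)
open import Data.List
  using (List; []; map; filter; length; concat; concatMap; deduplicate; inits; foldr)
open import Data.List.Properties
  using ( filter-++; filter-≐; filter-none; length-++; map-++; map-∘; map-cong; map-cong-local
        ; concat-map)
open import Data.List.Membership.DecPropositional _≟P_ using (_∈?_)
open import Data.List.Membership.Propositional using (_∈_)
open import Data.List.Membership.Propositional.Properties
  using (∈-deduplicate⁻; ∈-deduplicate⁺; ∈-++⁻; ∈-++⁺ˡ; ∈-++⁺ʳ; ∈-map⁻)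
open import Data.List.Membership.Propositional.Properties.WithK using (unique∧set⇒bag)
open import Data.List.Relation.Binary.BagAndSetEquality using (∼bag⇒↭)
open import Data.List.Relation.Binary.Permutation.Propositional as ↭
  using (_↭_; prep; swap; ↭-refl)
open import Data.List.Relation.Binary.Permutation.Propositional.Properties
  using (↭-length; filter-↭)
open import Data.List.Relation.Binary.Subset.DecPropositional using (_⊆?_)
open import Data.List.Relation.Binary.Subset.Propositional using (_⊆_)
open import Data.List.Relation.Binary.Subset.Propositional.Properties
  using (⊆-trans; ++⁺ʳ; map⁺)
open import Data.List.Relation.Unary.All as All using (All; []; _∷_; universal)
import Data.List.Relation.Unary.All.Properties as All
open import Data.List.Relation.Unary.AllPairs using ([]; _∷_)
open import Data.List.Relation.Unary.Unique.Propositional using (Unique)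
import Data.List.Relation.Unary.Unique.Propositional.Properties as Unique
open import Data.List.Relation.Unary.Unique.DecPropositional.Properties using (deduplicate-!)
open import Data.Nat using (ℕ; suc; _+_; _*_)
open import Data.Nat.ListAction using (sum)
open import Data.Nat.ListAction.Properties using (sum-++)
open import Data.Nat.Properties using (+-identityʳ; +-commutativeSemigroup) renaming (_≟_ to _≟ℕ_)
open import Data.Nat.Tactic.RingSolver using (solve-∀)
open import Data.Product using (_×_; _,_; proj₁; proj₂)
import Data.Sum as Sum
open import Function using (_∘_; mk⇔)
open import Relation.Binary.Definitions using (DecidableEquality)
open import Relation.Binary.PropositionalEquality
  using (_≢_; refl; sym; trans; cong; cong₂; subst; module ≡-Reasoning)
open import Relation.Nullary using (does; ¬_)
open import Relation.Nullary.Decidable using (True; toWitness)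
open import Relation.Nullary.Negation using (_¬-⊎_)
open import Relation.Unary using (Decidable)

open CommutativeSemigroupProperties +-commutativeSemigroup using (interchange)
open CommutativeSemigroupProperties (CommutativeMonoid.commutativeSemigroup ∧-commutativeMonoid)
  using (x∙yz≈y∙xz)

countSubsets : {A : Set} → (List A → Bool) → List A → ℕ
countSubsets p []       = if p [] then 1 else 0
countSubsets p (x ∷ xs) = countSubsets (p ∘ (x ∷_)) xs + countSubsets p xs

length-filter-map : {A B : Set} {P : B → Set} (P? : Decidable P) (f : A → B) (xs : List A) →
  length (filter P? (map f xs)) ≡ length (filter (P? ∘ f) xs)
length-filter-map P? f []       = refl
length-filter-map P? f (x ∷ xs) with does (P? (f x))
... | true  = cong suc (length-filter-map P? f xs)
... | false = length-filter-map P? f xs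

length-filter-subsets : {A : Set} {P : List A → Set} (P? : Decidable P) (xs : List A) →
  length (filter P? (subsets xs)) ≡ countSubsets (does ∘ P?) xs
length-filter-subsets P? [] with does (P? [])
... | true  = refl
... | false = refl
length-filter-subsets P? (x ∷ xs) = begin
  length (filter P? (map (x ∷_) (subsets xs) ++ subsets xs))
    ≡⟨ cong length (filter-++ P? (map (x ∷_) (subsets xs)) (subsets xs)) ⟩
  length (filter P? (map (x ∷_) (subsets xs)) ++ filter P? (subsets xs))
    ≡⟨ length-++ (filter P? (map (x ∷_) (subsets xs))) ⟩
  length (filter P? (map (x ∷_) (subsets xs))) + length (filter P? (subsets xs))
    ≡⟨ cong (_+ _) (length-filter-map P? (x ∷_) (subsets xs)) ⟩
  length (filter (P? ∘ (x ∷_)) (subsets xs)) + length (filter P? (subsets xs))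
    ≡⟨ cong₂ _+_ (length-filter-subsets (P? ∘ (x ∷_)) xs) (length-filter-subsets P? xs) ⟩
  countSubsets (does ∘ P? ∘ (x ∷_)) xs + countSubsets (does ∘ P?) xs ∎
  where open ≡-Reasoning

countSubsets-cong : {A : Set} {p q : List A → Bool} → (∀ S → p S ≡ q S) →
  ∀ xs → countSubsets p xs ≡ countSubsets q xs
countSubsets-cong p≗q []       = cong (λ b → if b then 1 else 0) (p≗q [])
countSubsets-cong p≗q (x ∷ xs) =
  cong₂ _+_ (countSubsets-cong (p≗q ∘ (x ∷_)) xs) (countSubsets-cong p≗q xs)

countSubsets-↭ : {A : Set} {p : List A → Bool} → (∀ {S T} → S ↭ T → p S ≡ p T) →
  ∀ {xs ys} → xs ↭ ys → countSubsets p xs ≡ countSubsets p ys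
countSubsets-↭ p-resp ↭.refl                 = refl
countSubsets-↭ p-resp (↭.trans xs↭ys ys↭zs) =
  trans (countSubsets-↭ p-resp xs↭ys) (countSubsets-↭ p-resp ys↭zs)
countSubsets-↭ p-resp (prep x xs↭ys)         =
  cong₂ _+_ (countSubsets-↭ (p-resp ∘ prep x) xs↭ys) (countSubsets-↭ p-resp xs↭ys)
countSubsets-↭ {A} {p} p-resp (swap {xs} {ys} x y xs↭ys) = begin
  (#xy xs + #x xs) + (#y xs + #p xs)  ≡⟨ interchange (#xy xs) (#x xs) (#y xs) (#p xs) ⟩
  (#xy xs + #y xs) + (#x xs + #p xs)  ≡⟨ cong₂ _+_ (cong₂ _+_ xy↦yx (countSubsets-↭ (p-resp ∘ prep y) xs↭ys))
                                                   (cong₂ _+_ (countSubsets-↭ (p-resp ∘ prep x) xs↭ys)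
                                                              (countSubsets-↭ p-resp xs↭ys)) ⟩
  (#yx ys + #y ys) + (#x ys + #p ys)  ∎
  where
  open ≡-Reasoning
  #p #x #y #xy #yx : List A → ℕ
  #p  = countSubsets p
  #x  = countSubsets (p ∘ (x ∷_))
  #y  = countSubsets (p ∘ (y ∷_))
  #xy = countSubsets (p ∘ (x ∷_) ∘ (y ∷_))
  #yx = countSubsets (p ∘ (y ∷_) ∘ (x ∷_))
  xy↦yx : #xy xs ≡ #yx ys
  xy↦yx = trans (countSubsets-cong (λ S → p-resp (swap x y ↭-refl)) xs)
                (countSubsets-↭ (p-resp ∘ prep y ∘ prep x) xs↭ys)

countSubsets-++ : {A : Set} (p : List A → Bool) (xs ys : List A) →
  countSubsets p (xs ++ ys) ≡ sum (map (λ X → countSubsets (p ∘ (X ++_)) ys) (subsets xs))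
countSubsets-++     p []       ys = sym (+-identityʳ _)
countSubsets-++ {A} p (x ∷ xs) ys = begin
  countSubsets (p ∘ (x ∷_)) (xs ++ ys) + countSubsets p (xs ++ ys)
    ≡⟨ cong₂ _+_ (countSubsets-++ (p ∘ (x ∷_)) xs ys) (countSubsets-++ p xs ys) ⟩
  sum (map (#after ∘ (x ∷_)) (subsets xs)) + sum (map #after (subsets xs))
    ≡⟨ cong (λ n → sum n + sum (map #after (subsets xs))) (map-∘ (subsets xs)) ⟩
  sum (map #after (map (x ∷_) (subsets xs))) + sum (map #after (subsets xs))
    ≡⟨ sum-++ (map #after (map (x ∷_) (subsets xs))) _ ⟨
  sum (map #after (map (x ∷_) (subsets xs)) ++ map #after (subsets xs))
    ≡⟨ cong sum (map-++ #after (map (x ∷_) (subsets xs)) (subsets xs)) ⟨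
  sum (map #after (map (x ∷_) (subsets xs) ++ subsets xs)) ∎
  where
  open ≡-Reasoning
  #after : List A → ℕ
  #after X = countSubsets (p ∘ (X ++_)) ys

countSubsets-map : {A B : Set} (p : List B → Bool) (f : A → B) (xs : List A) →
  countSubsets p (map f xs) ≡ countSubsets (p ∘ map f) xs
countSubsets-map p f []       = refl
countSubsets-map p f (x ∷ xs) =
  cong₂ _+_ (countSubsets-map (p ∘ (f x ∷_)) f xs) (countSubsets-map p f xs)

countSubsets-∧ : {A : Set} (b : Bool) (p : List A → Bool) (xs : List A) →
  countSubsets (λ S → b ∧ p S) xs ≡ (if b then countSubsets p xs else 0)
countSubsets-∧ true  p xs       = refl
countSubsets-∧ false p []       = refl
countSubsets-∧ false p (x ∷ xs) =
  cong₂ _+_ (countSubsets-∧ false (p ∘ (x ∷_)) xs) (countSubsets-∧ false p xs)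

all-++ : {A : Set} (p : A → Bool) (xs : List A) {ys : List A} → all p (xs ++ ys) ≡ all p xs ∧ all p ys
all-++ p []       = refl
all-++ p (x ∷ xs) = trans (cong (p x ∧_) (all-++ p xs)) (sym (∧-assoc (p x) _ _))

all-↭ : {A : Set} (p : A → Bool) {xs ys : List A} → xs ↭ ys → all p xs ≡ all p ys
all-↭ p ↭.refl                 = refl
all-↭ p (↭.trans xs↭ys ys↭zs) = trans (all-↭ p xs↭ys) (all-↭ p ys↭zs)
all-↭ p (prep x xs↭ys)         = cong (p x ∧_) (all-↭ p xs↭ys)
all-↭ p (swap x y xs↭ys)       =
  trans (x∙yz≈y∙xz (p x) (p y) _) (cong (λ b → p y ∧ (p x ∧ b)) (all-↭ p xs↭ys))

-- Q v k: whether v is acceptable when k of the chosen edges meet it.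
Constraint : Set
Constraint = Point → ℕ → Bool

satisfies : List Point → Constraint → List Edge → Bool
satisfies V Q S = all (λ v → Q v (degree v S)) V

residual : List Edge → Constraint → Constraint
residual Y Q v k = Q v (degree v Y + k)

degree-++ : ∀ v S T → degree v (S ++ T) ≡ degree v S + degree v T
degree-++ v S T = trans (cong length (filter-++ (v ∈ₑ?_) S T)) (length-++ (filter (v ∈ₑ?_) S))

degree-↭ : ∀ v {S T} → S ↭ T → degree v S ≡ degree v T
degree-↭ v S↭T = ↭-length (filter-↭ (v ∈ₑ?_) S↭T)

satisfies-vertices-↭ : ∀ {V W} Q S → V ↭ W → satisfies V Q S ≡ satisfies W Q S
satisfies-vertices-↭ Q S = all-↭ (λ v → Q v (degree v S))

satisfies-edges-↭ : ∀ V Q {S T} → S ↭ T → satisfies V Q S ≡ satisfies V Q T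
satisfies-edges-↭ V Q S↭T = cong and (map-cong (λ v → cong (Q v) (degree-↭ v S↭T)) V)

translate : Letter → Point → Point
translate 𝟎 (x , y) = suc x , y
translate 𝟏 (x , y) = x , suc y

shiftEdge : Letter → Edge → Edge
shiftEdge a (p , q) = translate a p , translate a q

translate-injective : ∀ a {p q} → translate a p ≡ translate a q → p ≡ q
translate-injective 𝟎 refl = refl
translate-injective 𝟏 refl = refl

shiftEdge-injective : ∀ a {e f} → shiftEdge a e ≡ shiftEdge a f → e ≡ f
shiftEdge-injective a eq =
  cong₂ _,_ (translate-injective a (cong proj₁ eq)) (translate-injective a (cong proj₂ eq))

vec-∷ : ∀ a p → vec (a ∷ p) ≡ translate a (vec p)
vec-∷ 𝟎 p = refl
vec-∷ 𝟏 p = refl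

degree-shiftEdge : ∀ a v S → degree (translate a v) (map (shiftEdge a) S) ≡ degree v S
degree-shiftEdge a v S =
  trans (length-filter-map (translate a v ∈ₑ?_) (shiftEdge a) S)
        (cong length (filter-≐ _ (v ∈ₑ?_) ( Sum.map (translate-injective a) (translate-injective a)
                                          , Sum.map (cong (translate a)) (cong (translate a))) S))

degree-shiftEdge-fresh : ∀ a {u} → (∀ p → u ≢ translate a p) → ∀ S → degree u (map (shiftEdge a) S) ≡ 0
degree-shiftEdge-fresh a {u} fresh S =
  cong length (filter-none (u ∈ₑ?_) (All.map⁺ (universal (λ e → fresh (proj₁ e) ¬-⊎ fresh (proj₂ e)) S)))

-- vertices and edges are tiling _≟P_ corners and tiling _≟E_ S, definitionally.
module Tiling {X : Set} (_≟_ : DecidableEquality X) (tile : Point → List X) where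

  tiling : Word → List X
  tiling w = deduplicate _≟_ (concatMap (tile ∘ vec) (inits w))

  tile-origin-⊆ : ∀ w → tile (0 , 0) ⊆ tiling w
  tile-origin-⊆ w = ∈-deduplicate⁺ _≟_ ∘ ∈-++⁺ˡ

  module Peel (a : Letter) (move : X → X) (tile-translate : ∀ g → tile (translate a g) ≡ map move (tile g))
    (new : List X) (new-unique : Unique new) (move-injective : ∀ {x y} → move x ≡ move y → x ≡ y)
    (new-fresh : All (λ z → ∀ x → z ≢ move x) new)
    (new⊆tile : new ⊆ tile (0 , 0)) (tile⊆ : tile (0 , 0) ⊆ new ++ map move (tile (0 , 0))) where

    concatMap-∷ : ∀ w →
      concatMap (tile ∘ vec) (inits (a ∷ w)) ≡ tile (0 , 0) ++ map move (concatMap (tile ∘ vec) (inits w))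
    concatMap-∷ w = cong (tile (0 , 0) ++_) (begin
      concat (map (tile ∘ vec) (map (a ∷_) (inits w)))      ≡⟨ cong concat (map-∘ (inits w)) ⟨
      concat (map (tile ∘ vec ∘ (a ∷_)) (inits w))          ≡⟨ cong concat (map-cong tile-∷ (inits w)) ⟩
      concat (map (map move ∘ tile ∘ vec) (inits w))        ≡⟨ cong concat (map-∘ (inits w)) ⟩
      concat (map (map move) (map (tile ∘ vec) (inits w)))  ≡⟨ concat-map (map (tile ∘ vec) (inits w)) ⟩
      map move (concatMap (tile ∘ vec) (inits w))           ∎)
      where
      open ≡-Reasoning
      tile-∷ : ∀ p → tile (vec (a ∷ p)) ≡ map move (tile (vec p))
      tile-∷ p = trans (cong tile (vec-∷ a p)) (tile-translate (vec p))

    peeled-⊆ : ∀ w → tiling (a ∷ w) ⊆ new ++ map move (tiling w)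
    peeled-⊆ w {z} z∈ with ∈-++⁻ (tile (0 , 0)) (subst (z ∈_) (concatMap-∷ w) (∈-deduplicate⁻ _≟_ _ z∈))
    ... | Sum.inj₁ z∈tile = ⊆-trans tile⊆ (++⁺ʳ new (map⁺ move (tile-origin-⊆ w))) z∈tile
    ... | Sum.inj₂ z∈rest = ∈-++⁺ʳ new (map⁺ move (∈-deduplicate⁺ _≟_) z∈rest)

    peeled-⊇ : ∀ w → new ++ map move (tiling w) ⊆ tiling (a ∷ w)
    peeled-⊇ w {z} z∈ = ∈-deduplicate⁺ _≟_ (subst (z ∈_) (sym (concatMap-∷ w))
      (Sum.[ ∈-++⁺ˡ ∘ new⊆tile , ∈-++⁺ʳ (tile (0 , 0)) ∘ map⁺ move (∈-deduplicate⁻ _≟_ _) ] (∈-++⁻ new z∈)))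

    peeled-unique : ∀ w → Unique (new ++ map move (tiling w))
    peeled-unique w = Unique.++⁺ new-unique (Unique.map⁺ move-injective (deduplicate-! _≟_ _)) disjoint
      where
      disjoint : ∀ {z} → ¬ (z ∈ new × z ∈ map move (tiling w))
      disjoint (z∈new , z∈image) with ∈-map⁻ move z∈image
      ... | x , _ , refl = All.lookup new-fresh z∈new x refl

    tiling-∷-↭ : ∀ w → tiling (a ∷ w) ↭ new ++ map move (tiling w)
    tiling-∷-↭ w =
      ∼bag⇒↭ (unique∧set⇒bag (deduplicate-! _≟_ _) (peeled-unique w) (mk⇔ (peeled-⊆ w) (peeled-⊇ w)))

⊆-by-decision : {X : Set} (_≟_ : DecidableEquality X) {xs ys : List X} {_ : True (_⊆?_ _≟_ xs ys)} → xs ⊆ ys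
⊆-by-decision _≟_ {_} {_} {xs⊆ys} = toWitness xs⊆ys

leftSide bottomSide : List Point
leftSide   = (0 , 0) ∷ (0 , 1) ∷ []
bottomSide = (0 , 0) ∷ (1 , 0) ∷ []

bottomEdge leftEdge rightEdge topEdge : Edge
bottomEdge = (0 , 0) , (1 , 0)
leftEdge   = (0 , 0) , (0 , 1)
rightEdge  = (1 , 0) , (1 , 1)
topEdge    = (0 , 1) , (1 , 1)

newVertices : Letter → List Point
newVertices 𝟎 = leftSide
newVertices 𝟏 = bottomSide

newEdges : Letter → List Edge
newEdges 𝟎 = bottomEdge ∷ leftEdge ∷ topEdge ∷ []
newEdges 𝟏 = bottomEdge ∷ leftEdge ∷ rightEdge ∷ []

corners-translate : ∀ a g → corners (translate a g) ≡ map (translate a) (corners g)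
corners-translate 𝟎 g = refl
corners-translate 𝟏 g = refl

S-translate : ∀ a g → S (translate a g) ≡ map (shiftEdge a) (S g)
S-translate 𝟎 g = refl
S-translate 𝟏 g = refl

newVertices-unique : ∀ a → Unique (newVertices a)
newVertices-unique 𝟎 = ((λ ()) ∷ []) ∷ [] ∷ []
newVertices-unique 𝟏 = ((λ ()) ∷ []) ∷ [] ∷ []

newEdges-unique : ∀ a → Unique (newEdges a)
newEdges-unique 𝟎 = ((λ ()) ∷ (λ ()) ∷ []) ∷ ((λ ()) ∷ []) ∷ [] ∷ []
newEdges-unique 𝟏 = ((λ ()) ∷ (λ ()) ∷ []) ∷ ((λ ()) ∷ []) ∷ [] ∷ []

newVertices-fresh : ∀ a → All (λ u → ∀ p → u ≢ translate a p) (newVertices a)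
newVertices-fresh 𝟎 = (λ p ()) ∷ (λ p ()) ∷ []
newVertices-fresh 𝟏 = (λ p ()) ∷ (λ p ()) ∷ []

newEdges-fresh : ∀ a → All (λ e → ∀ f → e ≢ shiftEdge a f) (newEdges a)
newEdges-fresh 𝟎 = (λ f ()) ∷ (λ f ()) ∷ (λ f ()) ∷ []
newEdges-fresh 𝟏 = (λ f ()) ∷ (λ f ()) ∷ (λ f ()) ∷ []

newVertices⊆corners : ∀ a → newVertices a ⊆ corners (0 , 0)
newVertices⊆corners 𝟎 = ⊆-by-decision _≟P_
newVertices⊆corners 𝟏 = ⊆-by-decision _≟P_

corners-origin-⊆ : ∀ a → corners (0 , 0) ⊆ newVertices a ++ map (translate a) (corners (0 , 0))
corners-origin-⊆ 𝟎 = ⊆-by-decision _≟P_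
corners-origin-⊆ 𝟏 = ⊆-by-decision _≟P_

newEdges⊆S : ∀ a → newEdges a ⊆ S (0 , 0)
newEdges⊆S 𝟎 = ⊆-by-decision _≟E_
newEdges⊆S 𝟏 = ⊆-by-decision _≟E_

S-origin-⊆ : ∀ a → S (0 , 0) ⊆ newEdges a ++ map (shiftEdge a) (S (0 , 0))
S-origin-⊆ 𝟎 = ⊆-by-decision _≟E_
S-origin-⊆ 𝟏 = ⊆-by-decision _≟E_

vertices-∷ : ∀ a w → vertices (a ∷ w) ↭ newVertices a ++ map (translate a) (vertices w)
vertices-∷ a = Tiling.Peel.tiling-∷-↭ _≟P_ corners a (translate a) (corners-translate a)
  (newVertices a) (newVertices-unique a) (translate-injective a) (newVertices-fresh a)
  (newVertices⊆corners a) (corners-origin-⊆ a)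

edges-∷ : ∀ a w → edges (a ∷ w) ↭ newEdges a ++ map (shiftEdge a) (edges w)
edges-∷ a = Tiling.Peel.tiling-∷-↭ _≟E_ S a (shiftEdge a) (S-translate a)
  (newEdges a) (newEdges-unique a) (shiftEdge-injective a) (newEdges-fresh a)
  (newEdges⊆S a) (S-origin-⊆ a)

satisfies-peel : ∀ a V Q Y S →
  satisfies (newVertices a ++ map (translate a) V) Q (Y ++ map (shiftEdge a) S) ≡
  satisfies (newVertices a) Q Y ∧ satisfies V (residual Y Q ∘ translate a) S
satisfies-peel a V Q Y S = begin
  all holds (newVertices a ++ map (translate a) V)
    ≡⟨ all-++ holds (newVertices a) ⟩
  all holds (newVertices a) ∧ all holds (map (translate a) V)
    ≡⟨ cong₂ _∧_ (cong and (map-cong-local (All.map at-new (newVertices-fresh a))))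
                 (cong and (trans (sym (map-∘ V)) (map-cong at-translate V))) ⟩
  satisfies (newVertices a) Q Y ∧ satisfies V (residual Y Q ∘ translate a) S ∎
  where
  open ≡-Reasoning
  holds : Point → Bool
  holds v = Q v (degree v (Y ++ map (shiftEdge a) S))
  at-new : ∀ {u} → (∀ p → u ≢ translate a p) → holds u ≡ Q u (degree u Y)
  at-new {u} fresh = cong (Q u) (begin
    degree u (Y ++ map (shiftEdge a) S)          ≡⟨ degree-++ u Y _ ⟩
    degree u Y + degree u (map (shiftEdge a) S)  ≡⟨ cong (degree u Y +_) (degree-shiftEdge-fresh a fresh S) ⟩
    degree u Y + 0                               ≡⟨ +-identityʳ _ ⟩
    degree u Y                                   ∎)
  at-translate : ∀ v → holds (translate a v) ≡ residual Y Q (translate a v) (degree v S)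
  at-translate v = cong (Q (translate a v))
    (trans (degree-++ (translate a v) Y _) (cong (degree (translate a v) Y +_) (degree-shiftEdge a v S)))

count : Word → Constraint → ℕ
count w Q = countSubsets (satisfies (vertices w) Q) (edges w)

count-cong : ∀ w {Q R} → (∀ v k → Q v k ≡ R v k) → count w Q ≡ count w R
count-cong w Q≗R = countSubsets-cong (λ S → cong and (map-cong (λ v → Q≗R v _) (vertices w))) (edges w)

count-∷ : ∀ a w Q → count (a ∷ w) Q ≡
  sum (map (λ Y → if satisfies (newVertices a) Q Y then count w (residual Y Q ∘ translate a) else 0)
           (subsets (newEdges a)))
count-∷ a w Q = begin
  countSubsets (satisfies (vertices (a ∷ w)) Q) (edges (a ∷ w))
    ≡⟨ countSubsets-cong (λ S → satisfies-vertices-↭ Q S (vertices-∷ a w)) (edges (a ∷ w)) ⟩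
  countSubsets (satisfies peeled Q) (edges (a ∷ w))
    ≡⟨ countSubsets-↭ (satisfies-edges-↭ peeled Q) (edges-∷ a w) ⟩
  countSubsets (satisfies peeled Q) (newEdges a ++ map (shiftEdge a) (edges w))
    ≡⟨ countSubsets-++ (satisfies peeled Q) (newEdges a) _ ⟩
  sum (map (λ Y → countSubsets (satisfies peeled Q ∘ (Y ++_)) (map (shiftEdge a) (edges w)))
           (subsets (newEdges a)))
    ≡⟨ cong sum (map-cong peel (subsets (newEdges a))) ⟩
  sum (map (λ Y → if satisfies (newVertices a) Q Y then count w (residual Y Q ∘ translate a) else 0)
           (subsets (newEdges a))) ∎
  where
  open ≡-Reasoning
  peeled : List Point
  peeled = newVertices a ++ map (translate a) (vertices w)
  peel : ∀ Y → countSubsets (satisfies peeled Q ∘ (Y ++_)) (map (shiftEdge a) (edges w)) ≡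
               (if satisfies (newVertices a) Q Y then count w (residual Y Q ∘ translate a) else 0)
  peel Y = begin
    countSubsets (satisfies peeled Q ∘ (Y ++_)) (map (shiftEdge a) (edges w))
      ≡⟨ countSubsets-map (satisfies peeled Q ∘ (Y ++_)) (shiftEdge a) (edges w) ⟩
    countSubsets (λ S → satisfies peeled Q (Y ++ map (shiftEdge a) S)) (edges w)
      ≡⟨ countSubsets-cong (satisfies-peel a (vertices w) Q Y) (edges w) ⟩
    countSubsets (λ S → satisfies (newVertices a) Q Y ∧ satisfies (vertices w) (residual Y Q ∘ translate a) S)
                 (edges w)
      ≡⟨ countSubsets-∧ (satisfies (newVertices a) Q Y) _ (edges w) ⟩
    (if satisfies (newVertices a) Q Y then count w (residual Y Q ∘ translate a) else 0) ∎

perfectWithout : List Point → Constraint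
perfectWithout U v k = if does (v ∈? U) then does (k ≟ℕ 0) else does (k ≟ℕ 1)

#PM : List Point → Word → ℕ
#PM U w = count w (perfectWithout U)

#M≡#PM : ∀ w → #M w ≡ #PM [] w
#M≡#PM w = trans (length-filter-subsets (isPerfectMatching? (vertices w)) (edges w))
                 (countSubsets-cong (isPerfectMatching?≗ (vertices w)) (edges w))
  where
  isPerfectMatching?≗ : ∀ V M → does (isPerfectMatching? V M) ≡ satisfies V (perfectWithout []) M
  isPerfectMatching?≗ []      M = refl
  isPerfectMatching?≗ (v ∷ V) M = cong (does (degree v M ≟ℕ 1) ∧_) (isPerfectMatching?≗ V M)

-- In each recurrence count-∷ evaluates the eight choices of first-tile edges;
-- the residual constraints of the admissible choices are identified pointwise.

#PM-𝟎∷ : ∀ w → #PM [] (𝟎 ∷ w) ≡ #PM leftSide w + #PM [] w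
#PM-𝟎∷ w = trans (count-∷ 𝟎 w (perfectWithout []))
  (cong₂ _+_ (count-cong w agree) (+-identityʳ (#PM [] w)))
  where
  agree : ∀ v k → residual (bottomEdge ∷ topEdge ∷ []) (perfectWithout []) (translate 𝟎 v) k ≡
                  perfectWithout leftSide v k
  agree (0 , 0)           k = refl
  agree (0 , 1)           k = refl
  agree (0 , suc (suc y)) k = refl
  agree (suc x , y)       k = refl

#PM-leftSide-𝟎∷ : ∀ w → #PM leftSide (𝟎 ∷ w) ≡ #PM [] w
#PM-leftSide-𝟎∷ w = trans (count-∷ 𝟎 w (perfectWithout leftSide)) (+-identityʳ (#PM [] w))

#PM-bottomSide-𝟎∷ : ∀ w → #PM bottomSide (𝟎 ∷ w) ≡ #PM leftSide w
#PM-bottomSide-𝟎∷ w = trans (count-∷ 𝟎 w (perfectWithout bottomSide))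
  (trans (+-identityʳ _) (count-cong w agree))
  where
  agree : ∀ v k → residual (topEdge ∷ []) (perfectWithout bottomSide) (translate 𝟎 v) k ≡
                  perfectWithout leftSide v k
  agree (0 , 0)           k = refl
  agree (0 , 1)           k = refl
  agree (0 , suc (suc y)) k = refl
  agree (suc x , y)       k = refl

#PM-𝟏∷ : ∀ w → #PM [] (𝟏 ∷ w) ≡ #PM [] w + #PM bottomSide w
#PM-𝟏∷ w = trans (count-∷ 𝟏 w (perfectWithout []))
  (cong₂ _+_ (count-cong w agree₁) (trans (+-identityʳ _) (count-cong w agree₂)))
  where
  agree₁ : ∀ v k → residual (bottomEdge ∷ []) (perfectWithout []) (translate 𝟏 v) k ≡ perfectWithout [] v k
  agree₁ (0 , y)           k = refl
  agree₁ (1 , y)           k = refl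
  agree₁ (suc (suc x) , y) k = refl
  agree₂ : ∀ v k → residual (leftEdge ∷ rightEdge ∷ []) (perfectWithout []) (translate 𝟏 v) k ≡
                   perfectWithout bottomSide v k
  agree₂ (0 , 0)           k = refl
  agree₂ (0 , suc y)       k = refl
  agree₂ (1 , 0)           k = refl
  agree₂ (1 , suc y)       k = refl
  agree₂ (suc (suc x) , y) k = refl

#PM-leftSide-𝟏∷ : ∀ w → #PM leftSide (𝟏 ∷ w) ≡ #PM bottomSide w
#PM-leftSide-𝟏∷ w = trans (count-∷ 𝟏 w (perfectWithout leftSide))
  (trans (+-identityʳ _) (count-cong w agree))
  where
  agree : ∀ v k → residual (rightEdge ∷ []) (perfectWithout leftSide) (translate 𝟏 v) k ≡
                  perfectWithout bottomSide v k
  agree (0 , 0)           k = refl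
  agree (0 , suc y)       k = refl
  agree (1 , 0)           k = refl
  agree (1 , suc y)       k = refl
  agree (suc (suc x) , y) k = refl

#PM-bottomSide-𝟏∷ : ∀ w → #PM bottomSide (𝟏 ∷ w) ≡ #PM [] w
#PM-bottomSide-𝟏∷ w = trans (count-∷ 𝟏 w (perfectWithout bottomSide))
  (trans (+-identityʳ _) (count-cong w agree))
  where
  agree : ∀ v k → residual [] (perfectWithout bottomSide) (translate 𝟏 v) k ≡ perfectWithout [] v k
  agree (0 , y)           k = refl
  agree (1 , y)           k = refl
  agree (suc (suc x) , y) k = refl

record Counts : Set where
  constructor counts
  field
    full noLeft noBottom : ℕ
open Counts

counts-cong : ∀ {f f′ l l′ b b′} → f ≡ f′ → l ≡ l′ → b ≡ b′ → counts f l b ≡ counts f′ l′ b′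
counts-cong refl refl refl = refl

transfer : Letter → Counts → Counts
transfer 𝟎 (counts f l b) = counts (l + f) f l
transfer 𝟏 (counts f l b) = counts (f + b) b f

snakeCounts : Word → Counts
snakeCounts = foldr transfer (counts 2 1 1)

matchingCounts : Word → Counts
matchingCounts w = counts (#PM [] w) (#PM leftSide w) (#PM bottomSide w)

matchingCounts-∷ : ∀ a w → matchingCounts (a ∷ w) ≡ transfer a (matchingCounts w)
matchingCounts-∷ 𝟎 w = counts-cong (#PM-𝟎∷ w) (#PM-leftSide-𝟎∷ w) (#PM-bottomSide-𝟎∷ w)
matchingCounts-∷ 𝟏 w = counts-cong (#PM-𝟏∷ w) (#PM-leftSide-𝟏∷ w) (#PM-bottomSide-𝟏∷ w)

matchingCounts≡snakeCounts : ∀ w → matchingCounts w ≡ snakeCounts w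
matchingCounts≡snakeCounts []      = counts-cong refl refl refl
matchingCounts≡snakeCounts (a ∷ w) =
  trans (matchingCounts-∷ a w) (cong (transfer a) (matchingCounts≡snakeCounts w))

record Represents (M : Mat) (c : Counts) : Set where
  constructor represents
  field
    full-≡   : full c ≡ a12 M + a22 M
    noLeft-≡ : noLeft c ≡ a12 M

twice-plus : ∀ q s → q + (q + s) ≡ 2 * q + 1 * s
twice-plus = solve-∀

represents-γL : ∀ x {M c} → Represents M c → Represents (μL x ⊗ M) (foldr transfer c (γL x))
represents-γL 𝟎 {mat _ q _ s} {counts _ _ _} (represents refl refl) = represents (full-eq q s) (twice-plus q s)
  where
  full-eq : ∀ q s → (q + s) + (q + (q + s)) ≡ (2 * q + 1 * s) + (1 * q + 1 * s)
  full-eq = solve-∀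
represents-γL 𝟏 {mat _ q _ s} {counts _ _ _} (represents refl refl) = represents (full-eq q s) (noLeft-eq q s)
  where
  full-eq : ∀ q s → (q + (q + s)) + (((q + (q + s)) + q) + (q + (q + s))) ≡ (5 * q + 2 * s) + (2 * q + 1 * s)
  full-eq = solve-∀
  noLeft-eq : ∀ q s → ((q + (q + s)) + q) + (q + (q + s)) ≡ 5 * q + 2 * s
  noLeft-eq = solve-∀

represents-γ : ∀ u → Represents (μ (u ++ [ 𝟏 ])) (snakeCounts (γ u ++ [ 𝟎 ]))
represents-γ []      = represents refl refl
represents-γ (𝟎 ∷ u) = represents-γL 𝟎 (represents-γ u)
represents-γ (𝟏 ∷ u) = represents-γL 𝟏 (represents-γ u)

represents⇒a12 : ∀ {M c} → Represents M c → a12 (μL 𝟎 ⊗ M) ≡ full (transfer 𝟎 c)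
represents⇒a12 {mat _ q _ s} {counts _ _ _} (represents refl refl) = sym (twice-plus q s)

corollary10p2 : (u : Word) → ProperChristoffel (𝟎 ∷ u ++ [ 𝟏 ]) →
    M₁₂ (μ (𝟎 ∷ u ++ [ 𝟏 ])) ≡ #M (𝟎 ∷ γ u ++ [ 𝟎 ])
corollary10p2 u _ = begin
  M₁₂ (μ (𝟎 ∷ u ++ [ 𝟏 ]))              ≡⟨ represents⇒a12 (represents-γ u) ⟩
  full (snakeCounts (𝟎 ∷ γ u ++ [ 𝟎 ]))  ≡⟨ cong full (matchingCounts≡snakeCounts (𝟎 ∷ γ u ++ [ 𝟎 ])) ⟨
  #PM [] (𝟎 ∷ γ u ++ [ 𝟎 ])             ≡⟨ #M≡#PM (𝟎 ∷ γ u ++ [ 𝟎 ]) ⟨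
  #M (𝟎 ∷ γ u ++ [ 𝟎 ])                 ∎
  where open ≡-Reasoning
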